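{- For every positive integer $k$ there exists a quadrangulation $Q_k$ with $n = 4k+2$ vertices such that the minimum size of an edge guard set of $Q_k$ is exactly $k = (n-2)/4$.
   Context: A plane graph is a simple graph together with a crossing-free embedding in $\mathbb{R}^2$ (edges need not be straight). A quadrangulation is a plane graph in which every face (including the outer face) is bounded by a $4$-cycle. For a plane graph $G=(V,E)$, a face $f$ is guarded by an edge $vw \in E$ if at least one of $v,w$ lies on the boundary of $f$. A set $\Gamma \subseteq E$ is an edge guard set if every face of $G$ (including the outer face) is guarded by some edge of $\Gamma$, i.e. every face has a boundary vertex that is an endpoint of some edge of $\Gamma$. -}

module Defs where

open import Data.Nat using (ℕ; zero; suc; _+_; _*_; _≤_)
open import Data.Fin using (Fin)
open import Data.Fin.Subset using (Subset; _∈_; ∣_∣)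
open import Data.Bool using (Bool; true; false; not)
open import Data.Product using (Σ; ∃; ∃-syntax; _×_; _,_; proj₁)
open import Relation.Binary.PropositionalEquality using (_≡_; _≢_)

-- Darts (half-edges) of a graph with e edges: edge i traversed in direction b.
Dart : ℕ → Set
Dart e = Fin e × Bool

rev : ∀ {e} → Dart e → Dart e
rev (i , b) = (i , not b)

iter : ∀ {A : Set} → (A → A) → ℕ → A → A
iter f zero    x = x
iter f (suc k) x = f (iter f k x)

-- Reachability in the graph whose darts have the given tails
-- (dart x goes from tail x to tail (rev x)).
data Reach {n e : ℕ} (tail : Dart e → Fin n) : Fin n → Fin n → Set where
  here : ∀ {u} → Reach tail u u
  step : ∀ {u} (x : Dart e) → Reach tail u (tail x) → Reach tail u (tail (rev x))

-- A plane graph with n vertices, e edges and f faces, given combinatorially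
-- by a connected rotation system (combinatorial map) of genus 0.
record PlaneGraph (n : ℕ) : Set where
  field
    e f   : ℕ
    -- tail vertex of each dart; edge i joins tail (i , false) and tail (i , true)
    tail  : Dart e → Fin n
    -- rotation: cyclic order of darts around each vertex (a permutation)
    σ     : Dart e → Dart e
    σ⁻¹   : Dart e → Dart e
    σ-inv₁ : ∀ x → σ (σ⁻¹ x) ≡ x
    σ-inv₂ : ∀ x → σ⁻¹ (σ x) ≡ x
    σ-tail : ∀ x → tail (σ x) ≡ tail x
    σ-cyclic : ∀ x y → tail x ≡ tail y → ∃[ k ] iter σ k x ≡ y
    noLoop  : ∀ i → tail (i , false) ≢ tail (i , true)
    noMulti : ∀ i j → tail (i , false) ≡ tail (j , false)
                    → tail (i , true) ≡ tail (j , true) → i ≡ j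
    noMulti' : ∀ i j → tail (i , false) ≡ tail (j , true)
                     → tail (i , true) ≡ tail (j , false) → i ≡ j
    -- faces: the orbits of the face permutation φ = σ ∘ rev, labelled by Fin f
    face  : Dart e → Fin f
    face-surj  : ∀ (F : Fin f) → ∃[ x ] face x ≡ F
    face-step  : ∀ x → face (σ (rev x)) ≡ face x
    face-orbit : ∀ x y → face x ≡ face y → ∃[ k ] iter (λ d → σ (rev d)) k x ≡ y
    connected : ∀ (u v : Fin n) → Reach tail u v
    -- genus 0: Euler's formula n - e + f = 2
    euler : n + f ≡ e + 2

  φ : Dart e → Dart e
  φ d = σ (rev d)

  OnBoundary : Fin n → Fin f → Set
  OnBoundary v F = ∃[ x ] (face x ≡ F × tail x ≡ v)

  GuardedBy : Fin f → Fin e → Set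
  GuardedBy F i = ∃[ b ] OnBoundary (tail (i , b)) F

  IsEdgeGuardSet : Subset e → Set
  IsEdgeGuardSet Γ = ∀ (F : Fin f) → ∃[ i ] (i ∈ Γ × GuardedBy F i)

  MinEdgeGuard≡ : ℕ → Set
  MinEdgeGuard≡ k = (∃[ Γ ] (IsEdgeGuardSet Γ × ∣ Γ ∣ ≡ k))
                  × (∀ Γ → IsEdgeGuardSet Γ → k ≤ ∣ Γ ∣)

-- every face (including the outer face) is bounded by a 4-cycle:
-- the boundary walk of each face has length 4 and visits 4 distinct vertices
IsQuadrangulation : ∀ {n} → PlaneGraph n → Set
IsQuadrangulation G =
  ∀ x → iter φ 4 x ≡ x
      × tail x ≢ tail (φ x) × tail x ≢ tail (iter φ 2 x) × tail x ≢ tail (iter φ 3 x)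
      × tail (φ x) ≢ tail (iter φ 2 x) × tail (φ x) ≢ tail (iter φ 3 x)
      × tail (iter φ 2 x) ≢ tail (iter φ 3 x)
  where open PlaneGraph G

{-# OPTIONS --safe #-}
-- Q_k has two poles X, Y and k + 1 blocks A_i, B_i, C_i, D_i, in which each of A_i, C_i is joined
-- to X, Y, B_i and D_i; the blocks are arranged cyclically around X and Y.  Its faces are
-- X A_i Y C_(i-1), X C_i B_i A_i, Y A_i D_i C_i and A_i B_i C_i D_i: all 4-cycles, and n - e + f = 2.
-- Every face contains some A_i, so the k + 1 edges A_i B_i guard all faces.  Conversely the face
-- A_i B_i C_i D_i can only be guarded by an edge with an end in block i, and every such edge lies in
-- block i; as the blocks partition the edges, an edge guard set needs one edge from each block.
module Submission where

open import Defs
open import Data.Bool using (Bool; true; false; not)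
open import Data.Bool.Properties using (not-involutive)
open import Data.Empty using (⊥-elim)
open import Data.Fin using (Fin; zero; suc; fromℕ; inject₁; combine)
open import Data.Fin.Induction using (<-weakInduction; >-weakInduction)
open import Data.Fin.Properties using (+↔⊎; *↔×)
open import Data.Fin.Subset using (Subset; inside; outside; _∈_; ∣_∣; ⁅_⁆; Nonempty)
open import Data.Fin.Subset.Properties using (x∈p⇒∣p-x∣<∣p∣; x∈⁅x⁆; ∣⁅x⁆∣≡1)
open import Data.Nat using (ℕ; zero; suc; _+_; _*_; _≤_; z≤n; s≤s)
open import Data.Nat.Properties using (≤-trans; +-mono-≤; *-identityʳ)
open import Data.Nat.Tactic.RingSolver using (solve-∀)
open import Data.Product using (_×_; _,_; proj₁; proj₂; ∃-syntax)
open import Data.Sum using (_⊎_; inj₁; inj₂)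
open import Data.Sum.Function.Propositional using (_⊎-↔_)
open import Data.Vec using (Vec; []; _∷_; _++_; concat; replicate; lookup; group)
open import Data.Vec.Properties using (lookup-++ˡ; lookup-++ʳ; lookup-replicate; []=⇒lookup; lookup⇒[]=)
open import Function using (_∘_; _↔_; Inverse; Injective)
open import Function.Bundles using (Injection)
open import Function.Properties.Inverse using (↔-refl; ↔-sym; ↔-trans; ↔⇒↣)
open import Relation.Binary.Construct.Closure.ReflexiveTransitive using (Star; ε; _◅_; _◅◅_; foldl; gmap; reverse)
open import Relation.Binary.PropositionalEquality

-- Subsets of Fin (m * c) as m consecutive blocks of size c

∣p++q∣≡∣p∣+∣q∣ : ∀ {a b} (p : Subset a) (q : Subset b) → ∣ p ++ q ∣ ≡ ∣ p ∣ + ∣ q ∣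
∣p++q∣≡∣p∣+∣q∣ []            q = refl
∣p++q∣≡∣p∣+∣q∣ (outside ∷ p) q = ∣p++q∣≡∣p∣+∣q∣ p q
∣p++q∣≡∣p∣+∣q∣ (inside ∷ p)  q = cong suc (∣p++q∣≡∣p∣+∣q∣ p q)

Nonempty⇒1≤∣p∣ : ∀ {n} {p : Subset n} → Nonempty p → 1 ≤ ∣ p ∣
Nonempty⇒1≤∣p∣ (_ , x∈p) = ≤-trans (s≤s z≤n) (x∈p⇒∣p-x∣<∣p∣ x∈p)

lookup-concat : ∀ {A : Set} {m c} (xss : Vec (Vec A c) m) i j →
                lookup (concat xss) (combine i j) ≡ lookup (lookup xss i) j
lookup-concat (xs ∷ xss) zero    j = lookup-++ˡ xs (concat xss) j
lookup-concat (xs ∷ xss) (suc i) j =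
  trans (lookup-++ʳ xs (concat xss) (combine i j)) (lookup-concat xss i j)

combine∈concat⁻ : ∀ {m c} (ps : Vec (Subset c) m) i j → combine i j ∈ concat ps → j ∈ lookup ps i
combine∈concat⁻ ps i j ij∈ =
  lookup⇒[]= j (lookup ps i) (trans (sym (lookup-concat ps i j)) ([]=⇒lookup ij∈))

combine∈concat⁺ : ∀ {m c} (ps : Vec (Subset c) m) i j → j ∈ lookup ps i → combine i j ∈ concat ps
combine∈concat⁺ ps i j j∈ =
  lookup⇒[]= (combine i j) (concat ps) (trans (lookup-concat ps i j) ([]=⇒lookup j∈))

allNonempty⇒m≤∣concat∣ : ∀ {m c} (ps : Vec (Subset c) m) →
                          (∀ i → Nonempty (lookup ps i)) → m ≤ ∣ concat ps ∣
allNonempty⇒m≤∣concat∣ []       _  = z≤n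
allNonempty⇒m≤∣concat∣ (p ∷ ps) ne = subst (suc _ ≤_) (sym (∣p++q∣≡∣p∣+∣q∣ p (concat ps)))
  (+-mono-≤ (Nonempty⇒1≤∣p∣ (ne zero)) (allNonempty⇒m≤∣concat∣ ps (ne ∘ suc)))

meetsAllBlocks⇒m≤∣p∣ : ∀ m {c} (p : Subset (m * c)) → (∀ i → ∃[ j ] combine i j ∈ p) → m ≤ ∣ p ∣
meetsAllBlocks⇒m≤∣p∣ m {c} p meets with group m c p
... | ps , refl = allNonempty⇒m≤∣concat∣ ps λ i →
  let j , ij∈ = meets i in j , combine∈concat⁻ ps i j ij∈

∣concat-replicate∣ : ∀ m {c} (q : Subset c) → ∣ concat (replicate m q) ∣ ≡ m * ∣ q ∣
∣concat-replicate∣ zero    q = refl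
∣concat-replicate∣ (suc m) q =
  trans (∣p++q∣≡∣p∣+∣q∣ q _) (cong (∣ q ∣ +_) (∣concat-replicate∣ m q))

module _ {A : Set} where

  Orbit : (A → A) → A → A → Set
  Orbit f = Star (λ x y → f x ≡ y)

  module _ {f : A → A} where

    Orbit⇒iter : ∀ {x y} → Orbit f x y → ∃[ n ] iter f n x ≡ y
    Orbit⇒iter = foldl (λ x y → ∃[ n ] iter f n x ≡ y) (λ (n , p) q → suc n , trans (cong f p) q) (0 , refl)

    orbit-iter : ∀ n x → Orbit f x (iter f n x)
    orbit-iter zero    x = ε
    orbit-iter (suc n) x = orbit-iter n x ◅◅ (refl ◅ ε)

    iter-suc : ∀ n x → iter f (suc n) x ≡ iter f n (f x)
    iter-suc zero    x = refl
    iter-suc (suc n) x = cong f (iter-suc n x)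

    periodic⇒returns : ∀ n → (∀ x → iter f (suc n) x ≡ x) → ∀ x → Orbit f (f x) x
    periodic⇒returns n period x =
      subst (Orbit f (f x)) (trans (sym (iter-suc n x)) (period x)) (orbit-iter n (f x))

    orbit-sym : (∀ x → Orbit f (f x) x) → ∀ {x y} → Orbit f x y → Orbit f y x
    orbit-sym returns ε          = ε
    orbit-sym returns (refl ◅ o) = orbit-sym returns o ◅◅ returns _

    orbit-inverse : ∀ {g : A → A} → (∀ x → g (f x) ≡ x) → ∀ {x y} → Orbit f x y → Orbit g y x
    orbit-inverse gf ε          = ε
    orbit-inverse gf (refl ◅ o) = orbit-inverse gf o ◅◅ (gf _ ◅ ε)

    orbit-via-representative : ∀ {K : Set} (key : A → K) (rep : K → A) →
      (∀ x → Orbit f (f x) x) → (∀ x → Orbit f x (rep (key x))) →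
      ∀ x y → key x ≡ key y → Orbit f x y
    orbit-via-representative key rep returns toRep x y kx≡ky =
      toRep x ◅◅ subst (λ k → Orbit f (rep k) y) (sym kx≡ky) (orbit-sym returns (toRep y))

module _ {A B : Set} {f : A → A} {g : B → B} (h : A → B) (h-comm : ∀ x → g (h x) ≡ h (f x)) where

  iter-comm : ∀ n x → iter g n (h x) ≡ h (iter f n x)
  iter-comm zero    x = refl
  iter-comm (suc n) x = trans (cong g (iter-comm n x)) (h-comm (iter f n x))

  orbit-map : ∀ {x y} → Orbit f x y → Orbit g (h x) (h y)
  orbit-map = gmap h λ {x} fx≡y → trans (h-comm x) (cong h fx≡y)

-- Shaped exactly like the body of IsQuadrangulation, which therefore unfolds to it.
Quadrilateral : {D W : Set} → (D → W) → (D → D) → D → Set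
Quadrilateral t φ x =
  iter φ 4 x ≡ x
  × t x ≢ t (φ x) × t x ≢ t (iter φ 2 x) × t x ≢ t (iter φ 3 x)
  × t (φ x) ≢ t (iter φ 2 x) × t (φ x) ≢ t (iter φ 3 x)
  × t (iter φ 2 x) ≢ t (iter φ 3 x)

quadrilateral-map : ∀ {D D′ W W′ : Set} {t : D → W} {t′ : D′ → W′} {φ : D → D} {φ′ : D′ → D′}
  (h : D → D′) (g : W → W′) → Injective _≡_ _≡_ g →
  (∀ x → φ′ (h x) ≡ h (φ x)) → (∀ x → t′ (h x) ≡ g (t x)) →
  ∀ {x} → Quadrilateral t φ x → Quadrilateral t′ φ′ (h x)
quadrilateral-map {t = t} {t′} {φ} {φ′} h g g-inj h-comm t-comm {x}
  (period , n₀₁ , n₀₂ , n₀₃ , n₁₂ , n₁₃ , n₂₃) =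
  trans (iter-comm {g = φ′} h h-comm 4 x) (cong h period) ,
  lift 0 1 n₀₁ , lift 0 2 n₀₂ , lift 0 3 n₀₃ , lift 1 2 n₁₂ , lift 1 3 n₁₃ , lift 2 3 n₂₃
  where
    t-iter : ∀ i → t′ (iter φ′ i (h x)) ≡ g (t (iter φ i x))
    t-iter i = trans (cong t′ (iter-comm {g = φ′} h h-comm i x)) (t-comm (iter φ i x))

    lift : ∀ i j → t (iter φ i x) ≢ t (iter φ j x) → t′ (iter φ′ i (h x)) ≢ t′ (iter φ′ j (h x))
    lift i j ne eq = ne (g-inj (trans (sym (t-iter i)) (trans eq (t-iter j))))

-- next is the cyclic successor on Fin (suc k); bump keeps its wrap-around value zero in place.
bump : ∀ {k} → Fin (suc k) → Fin (suc (suc k))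
bump zero    = zero
bump (suc i) = suc (suc i)

next : ∀ {k} → Fin (suc k) → Fin (suc k)
next {zero}  zero    = zero
next {suc k} zero    = suc zero
next {suc k} (suc i) = bump (next i)

prev : ∀ {k} → Fin (suc k) → Fin (suc k)
prev {k} zero    = fromℕ k
prev     (suc i) = inject₁ i

next-inject₁ : ∀ {k} (i : Fin k) → next (inject₁ i) ≡ suc i
next-inject₁ {suc k} zero    = refl
next-inject₁ {suc k} (suc i) = cong bump (next-inject₁ i)

next-fromℕ : ∀ k → next (fromℕ k) ≡ zero
next-fromℕ zero    = refl
next-fromℕ (suc k) = cong bump (next-fromℕ k)

next-prev : ∀ {k} (i : Fin (suc k)) → next (prev i) ≡ i
next-prev {k} zero = next-fromℕ k
next-prev (suc i)  = next-inject₁ i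

prev-next : ∀ {k} (i : Fin (suc k)) → prev (next i) ≡ i
prev-next {zero}  zero    = refl
prev-next {suc k} zero    = refl
prev-next {suc k} (suc i) = trans (prev-bump (next i)) (cong suc (prev-next i))
  where
    prev-bump : ∀ (j : Fin (suc k)) → prev (bump j) ≡ suc (prev j)
    prev-bump zero    = refl
    prev-bump (suc j) = refl

orbit-next : ∀ {k} (i j : Fin (suc k)) → Orbit next i j
orbit-next {k} i j = to-zero i ◅◅ from-zero j
  where
    from-zero : ∀ j → Orbit next zero j
    from-zero = <-weakInduction (Orbit next zero) ε λ i o → o ◅◅ (next-inject₁ i ◅ ε)

    to-zero : ∀ i → Orbit next i zero
    to-zero = >-weakInduction (λ i → Orbit next i zero) (next-fromℕ k ◅ ε) λ i o → next-inject₁ i ◅ o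

orbit-prev : ∀ {k} (i j : Fin (suc k)) → Orbit prev i j
orbit-prev i j = orbit-inverse prev-next (orbit-next j i)

-- Plane maps and their transport to PlaneGraph

twin : ∀ {E : Set} → E × Bool → E × Bool
twin (a , b) = (a , not b)

twin-involutive : ∀ {E : Set} (d : E × Bool) → twin (twin d) ≡ d
twin-involutive (a , b) = cong (a ,_) (not-involutive b)

Adjacent : ∀ {V E : Set} → (E × Bool → V) → V → V → Set
Adjacent tail u v = ∃[ d ] tail d ≡ u × tail (twin d) ≡ v

Adjacent-sym : ∀ {V E : Set} {tail : E × Bool → V} {u v} → Adjacent tail u v → Adjacent tail v u
Adjacent-sym {tail = tail} (d , tail-d , tail-twin-d) =
  twin d , tail-twin-d , trans (cong tail (twin-involutive d)) tail-d

adjacent : ∀ {V E : Set} {tail : E × Bool → V} d → Adjacent tail (tail d) (tail (twin d))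
adjacent d = d , refl , refl

-- A PlaneGraph over arbitrary carriers, so that the construction can match on structured names.
record PlaneMap (V E F : Set) : Set where
  field
    tail       : E × Bool → V
    σ σ⁻¹      : E × Bool → E × Bool
    σ-inv₁     : ∀ d → σ (σ⁻¹ d) ≡ d
    σ-inv₂     : ∀ d → σ⁻¹ (σ d) ≡ d
    σ-tail     : ∀ d → tail (σ d) ≡ tail d
    σ-cyclic   : ∀ d d′ → tail d ≡ tail d′ → Orbit σ d d′
    noLoop     : ∀ a → tail (a , false) ≢ tail (a , true)
    noMulti    : ∀ a a′ → tail (a , false) ≡ tail (a′ , false) → tail (a , true) ≡ tail (a′ , true) → a ≡ a′
    noMulti'   : ∀ a a′ → tail (a , false) ≡ tail (a′ , true) → tail (a , true) ≡ tail (a′ , false) → a ≡ a′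
    face       : E × Bool → F
    face-surj  : ∀ F → ∃[ d ] face d ≡ F
    face-step  : ∀ d → face (σ (twin d)) ≡ face d
    face-orbit : ∀ d d′ → face d ≡ face d′ → Orbit (σ ∘ twin) d d′
    connected  : ∀ u v → Star (Adjacent tail) u v

  φ : E × Bool → E × Bool
  φ = σ ∘ twin

  GuardedBy : F → E → Set
  GuardedBy F a = ∃[ b ] ∃[ d ] face d ≡ F × tail d ≡ tail (a , b)

module Transport {V E F : Set} {n e f : ℕ} (M : PlaneMap V E F)
  (vertices : V ↔ Fin n) (edges : E ↔ Fin e) (faces : F ↔ Fin f) (euler : n + f ≡ e + 2) where

  open PlaneMap M
  private
    module Vᴵ = Inverse vertices
    module Eᴵ = Inverse edges
    module Fᴵ = Inverse faces

    injective : ∀ {A B : Set} (i : A ↔ B) → Injective _≡_ _≡_ (Inverse.to i)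
    injective i = Injection.injective (↔⇒↣ i)

  encode : E × Bool → Dart e
  encode (a , b) = (Eᴵ.to a , b)

  decode : Dart e → E × Bool
  decode (i , b) = (Eᴵ.from i , b)

  decode-encode : ∀ d → decode (encode d) ≡ d
  decode-encode (a , b) = cong (_, b) (Eᴵ.strictlyInverseʳ a)

  encode-decode : ∀ x → encode (decode x) ≡ x
  encode-decode (i , b) = cong (_, b) (Eᴵ.strictlyInverseˡ i)

  conjugate : (E × Bool → E × Bool) → Dart e → Dart e
  conjugate g = encode ∘ g ∘ decode

  conjugate-encode : ∀ g d → conjugate g (encode d) ≡ encode (g d)
  conjugate-encode g d = cong (encode ∘ g) (decode-encode d)

  tailᴳ : Dart e → Fin n
  tailᴳ = Vᴵ.to ∘ tail ∘ decode

  faceᴳ : Dart e → Fin f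
  faceᴳ = Fᴵ.to ∘ face ∘ decode

  tail-encode : ∀ d → tailᴳ (encode d) ≡ Vᴵ.to (tail d)
  tail-encode d = cong (Vᴵ.to ∘ tail) (decode-encode d)

  face-encode : ∀ d → faceᴳ (encode d) ≡ Fᴵ.to (face d)
  face-encode d = cong (Fᴵ.to ∘ face) (decode-encode d)

  orbit-conjugate : ∀ g x y → Orbit g (decode x) (decode y) → ∃[ k ] iter (conjugate g) k x ≡ y
  orbit-conjugate g x y o =
    Orbit⇒iter (subst₂ (Orbit (conjugate g)) (encode-decode x) (encode-decode y)
                       (orbit-map encode (conjugate-encode g) o))

  adjacency⇒Reach : ∀ {u v} → Star (Adjacent tail) u v → Reach tailᴳ (Vᴵ.to u) (Vᴵ.to v)
  adjacency⇒Reach = foldl (λ u v → Reach tailᴳ (Vᴵ.to u) (Vᴵ.to v)) extend here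
    where
      extend : ∀ {u v w} → Reach tailᴳ (Vᴵ.to u) (Vᴵ.to v) → Adjacent tail v w → Reach tailᴳ (Vᴵ.to u) (Vᴵ.to w)
      extend r (d , refl , refl) =
        subst (Reach tailᴳ _) (tail-encode (twin d))
              (step (encode d) (subst (Reach tailᴳ _) (sym (tail-encode d)) r))

  G : PlaneGraph n
  G = record
    { e          = e
    ; f          = f
    ; tail       = tailᴳ
    ; σ          = conjugate σ
    ; σ⁻¹        = conjugate σ⁻¹
    ; σ-inv₁     = λ x → trans (conjugate-encode σ _) (trans (cong encode (σ-inv₁ _)) (encode-decode x))
    ; σ-inv₂     = λ x → trans (conjugate-encode σ⁻¹ _) (trans (cong encode (σ-inv₂ _)) (encode-decode x))
    ; σ-tail     = λ x → trans (tail-encode _) (cong Vᴵ.to (σ-tail _))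
    ; σ-cyclic   = λ x y eq → orbit-conjugate σ x y (σ-cyclic _ _ (injective vertices eq))
    ; noLoop     = λ i eq → noLoop _ (injective vertices eq)
    ; noMulti    = λ i j p q → injective (↔-sym edges) (noMulti _ _ (injective vertices p) (injective vertices q))
    ; noMulti'   = λ i j p q → injective (↔-sym edges) (noMulti' _ _ (injective vertices p) (injective vertices q))
    ; face       = faceᴳ
    ; face-surj  = λ F → let d , face-d = face-surj (Fᴵ.from F) in
                   encode d , trans (face-encode d) (trans (cong Fᴵ.to face-d) (Fᴵ.strictlyInverseˡ F))
    ; face-step  = λ x → trans (face-encode _) (cong Fᴵ.to (face-step _))
    ; face-orbit = λ x y eq → orbit-conjugate φ x y (face-orbit _ _ (injective faces eq))
    ; connected  = λ u v → subst₂ (Reach tailᴳ) (Vᴵ.strictlyInverseˡ u) (Vᴵ.strictlyInverseˡ v)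
                             (adjacency⇒Reach (connected (Vᴵ.from u) (Vᴵ.from v)))
    ; euler      = euler
    }

  quadrangulation : (∀ d → Quadrilateral tail φ d) → IsQuadrangulation G
  quadrangulation quad x =
    subst (Quadrilateral tailᴳ (conjugate φ)) (encode-decode x)
      (quadrilateral-map {t′ = tailᴳ} {φ′ = conjugate φ} encode Vᴵ.to (injective vertices)
                         (conjugate-encode φ) tail-encode (quad (decode x)))

  open PlaneGraph G using () renaming (GuardedBy to GuardedByᴳ)

  guardedBy⁺ : ∀ {F a} → GuardedBy F a → GuardedByᴳ (Fᴵ.to F) (Eᴵ.to a)
  guardedBy⁺ {a = a} (b , d , face-d , tail-d) =
    b , encode d , trans (face-encode d) (cong Fᴵ.to face-d) ,
    trans (tail-encode d) (trans (cong Vᴵ.to tail-d) (sym (tail-encode (a , b))))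

  guardedBy⁻ : ∀ {F i} → GuardedByᴳ F i → GuardedBy (Fᴵ.from F) (Eᴵ.from i)
  guardedBy⁻ (b , x , face-x , tail-x) =
    b , decode x , trans (sym (Fᴵ.strictlyInverseʳ _)) (cong Fᴵ.from face-x) , injective vertices tail-x

-- The quadrangulation Q_k

euler-count : ∀ m → 4 * m + 2 + m * 4 ≡ m * 8 + 2
euler-count = solve-∀

module Construction (k : ℕ) where

  m : ℕ
  m = suc k

  -- Vertices, edges and faces are products and sums of Fin, read through pattern synonyms, so that
  -- the bijections with Fin n, Fin e and Fin f come from Data.Fin.Properties.  Edge (i , l) of
  -- block i joins the hub named first in l to the vertex named second; out i l leaves the hub.
  Vertex : Set
  Vertex = (Fin 4 × Fin m) ⊎ Fin 2

  pattern A i = inj₁ (zero , i)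
  pattern B i = inj₁ (suc zero , i)
  pattern C i = inj₁ (suc (suc zero) , i)
  pattern D i = inj₁ (suc (suc (suc zero)) , i)
  pattern X   = inj₂ zero
  pattern Y   = inj₂ (suc zero)

  Label : Set
  Label = Fin 8

  pattern AX = zero
  pattern AY = suc zero
  pattern AB = suc (suc zero)
  pattern AD = suc (suc (suc zero))
  pattern CX = suc (suc (suc (suc zero)))
  pattern CY = suc (suc (suc (suc (suc zero))))
  pattern CB = suc (suc (suc (suc (suc (suc zero)))))
  pattern CD = suc (suc (suc (suc (suc (suc (suc zero))))))

  Edge : Set
  Edge = Fin m × Label

  pattern out  i l = ((i , l) , false)
  pattern into i l = ((i , l) , true)

  -- (i , XY) is X A_i Y C_(i-1), (i , XB) is X C_i B_i A_i, (i , YD) is Y A_i D_i C_i and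
  -- (i , BD) is A_i B_i C_i D_i.
  Face : Set
  Face = Fin m × Fin 4

  pattern XY = zero
  pattern XB = suc zero
  pattern YD = suc (suc zero)
  pattern BD = suc (suc (suc zero))

  tail : Edge × Bool → Vertex
  tail (out  i AX) = A i
  tail (out  i AY) = A i
  tail (out  i AB) = A i
  tail (out  i AD) = A i
  tail (out  i CX) = C i
  tail (out  i CY) = C i
  tail (out  i CB) = C i
  tail (out  i CD) = C i
  tail (into i AX) = X
  tail (into i AY) = Y
  tail (into i AB) = B i
  tail (into i AD) = D i
  tail (into i CX) = X
  tail (into i CY) = Y
  tail (into i CB) = B i
  tail (into i CD) = D i

  σ : Edge × Bool → Edge × Bool
  σ (out  i AY) = out  i AD
  σ (out  i AD) = out  i AB
  σ (out  i AB) = out  i AX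
  σ (out  i AX) = out  i AY
  σ (out  i CY) = out  i CX
  σ (out  i CX) = out  i CB
  σ (out  i CB) = out  i CD
  σ (out  i CD) = out  i CY
  σ (into i AX) = into i CX
  σ (into i CX) = into (next i) AX
  σ (into i CY) = into i AY
  σ (into i AY) = into (prev i) CY
  σ (into i AB) = into i CB
  σ (into i CB) = into i AB
  σ (into i AD) = into i CD
  σ (into i CD) = into i AD

  σ⁻¹ : Edge × Bool → Edge × Bool
  σ⁻¹ (out  i AD) = out  i AY
  σ⁻¹ (out  i AB) = out  i AD
  σ⁻¹ (out  i AX) = out  i AB
  σ⁻¹ (out  i AY) = out  i AX
  σ⁻¹ (out  i CX) = out  i CY
  σ⁻¹ (out  i CB) = out  i CX
  σ⁻¹ (out  i CD) = out  i CB
  σ⁻¹ (out  i CY) = out  i CD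
  σ⁻¹ (into i CX) = into i AX
  σ⁻¹ (into i AX) = into (prev i) CX
  σ⁻¹ (into i AY) = into i CY
  σ⁻¹ (into i CY) = into (next i) AY
  σ⁻¹ (into i CB) = into i AB
  σ⁻¹ (into i AB) = into i CB
  σ⁻¹ (into i CD) = into i AD
  σ⁻¹ (into i AD) = into i CD

  face : Edge × Bool → Face
  face (into i AX) = (i , XY)
  face (out  i AY) = (i , XY)
  face (into i CY) = (next i , XY)
  face (out  i CX) = (next i , XY)
  face (into i CX) = (i , XB)
  face (out  i CB) = (i , XB)
  face (into i AB) = (i , XB)
  face (out  i AX) = (i , XB)
  face (into i AY) = (i , YD)
  face (out  i AD) = (i , YD)
  face (into i CD) = (i , YD)
  face (out  i CY) = (i , YD)
  face (out  i AB) = (i , BD)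
  face (into i CB) = (i , BD)
  face (out  i CD) = (i , BD)
  face (into i AD) = (i , BD)

  φ : Edge × Bool → Edge × Bool
  φ = σ ∘ twin

  σ-inv₁ : ∀ d → σ (σ⁻¹ d) ≡ d
  σ-inv₁ (into i AX) = cong (λ j → into j AX) (next-prev i)
  σ-inv₁ (into i CY) = cong (λ j → into j CY) (prev-next i)
  σ-inv₁ (into i AY) = refl
  σ-inv₁ (into i CX) = refl
  σ-inv₁ (into i AB) = refl
  σ-inv₁ (into i AD) = refl
  σ-inv₁ (into i CB) = refl
  σ-inv₁ (into i CD) = refl
  σ-inv₁ (out  i AX) = refl
  σ-inv₁ (out  i AY) = refl
  σ-inv₁ (out  i AB) = refl
  σ-inv₁ (out  i AD) = refl
  σ-inv₁ (out  i CX) = refl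
  σ-inv₁ (out  i CY) = refl
  σ-inv₁ (out  i CB) = refl
  σ-inv₁ (out  i CD) = refl

  σ-inv₂ : ∀ d → σ⁻¹ (σ d) ≡ d
  σ-inv₂ (into i CX) = cong (λ j → into j CX) (prev-next i)
  σ-inv₂ (into i AY) = cong (λ j → into j AY) (next-prev i)
  σ-inv₂ (into i AX) = refl
  σ-inv₂ (into i CY) = refl
  σ-inv₂ (into i AB) = refl
  σ-inv₂ (into i AD) = refl
  σ-inv₂ (into i CB) = refl
  σ-inv₂ (into i CD) = refl
  σ-inv₂ (out  i AX) = refl
  σ-inv₂ (out  i AY) = refl
  σ-inv₂ (out  i AB) = refl
  σ-inv₂ (out  i AD) = refl
  σ-inv₂ (out  i CX) = refl
  σ-inv₂ (out  i CY) = refl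
  σ-inv₂ (out  i CB) = refl
  σ-inv₂ (out  i CD) = refl

  σ-tail : ∀ d → tail (σ d) ≡ tail d
  σ-tail (into i AX) = refl
  σ-tail (into i AY) = refl
  σ-tail (into i AB) = refl
  σ-tail (into i AD) = refl
  σ-tail (into i CX) = refl
  σ-tail (into i CY) = refl
  σ-tail (into i CB) = refl
  σ-tail (into i CD) = refl
  σ-tail (out  i AX) = refl
  σ-tail (out  i AY) = refl
  σ-tail (out  i AB) = refl
  σ-tail (out  i AD) = refl
  σ-tail (out  i CX) = refl
  σ-tail (out  i CY) = refl
  σ-tail (out  i CB) = refl
  σ-tail (out  i CD) = refl

  x-orbit : ∀ i j → Orbit σ (into i AX) (into j AX)
  x-orbit i j = along (orbit-next i j)
    where
      along : ∀ {i j} → Orbit next i j → Orbit σ (into i AX) (into j AX)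
      along ε          = ε
      along (refl ◅ o) = refl ◅ refl ◅ along o

  y-orbit : ∀ i j → Orbit σ (into i AY) (into j AY)
  y-orbit i j = along (orbit-prev i j)
    where
      along : ∀ {i j} → Orbit prev i j → Orbit σ (into i AY) (into j AY)
      along ε          = ε
      along (refl ◅ o) = refl ◅ refl ◅ along o

  σ-returns : ∀ d → Orbit σ (σ d) d
  σ-returns (into i AX) = refl ◅ x-orbit (next i) i
  σ-returns (into i CX) = x-orbit (next i) i ◅◅ (refl ◅ ε)
  σ-returns (into i AY) = refl ◅ y-orbit (prev i) i
  σ-returns (into i CY) = y-orbit i (next i) ◅◅ (cong (λ j → into j CY) (prev-next i) ◅ ε)
  σ-returns (into i AB) = orbit-iter 1 _
  σ-returns (into i AD) = orbit-iter 1 _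
  σ-returns (into i CB) = orbit-iter 1 _
  σ-returns (into i CD) = orbit-iter 1 _
  σ-returns (out  i AX) = orbit-iter 3 _
  σ-returns (out  i AY) = orbit-iter 3 _
  σ-returns (out  i AB) = orbit-iter 3 _
  σ-returns (out  i AD) = orbit-iter 3 _
  σ-returns (out  i CX) = orbit-iter 3 _
  σ-returns (out  i CY) = orbit-iter 3 _
  σ-returns (out  i CB) = orbit-iter 3 _
  σ-returns (out  i CD) = orbit-iter 3 _

  vertex-dart : Vertex → Edge × Bool
  vertex-dart (A i) = out  i AX
  vertex-dart (B i) = into i AB
  vertex-dart (C i) = out  i CX
  vertex-dart (D i) = into i AD
  vertex-dart X     = into zero AX
  vertex-dart Y     = into zero AY

  to-vertex-dart : ∀ d → Orbit σ d (vertex-dart (tail d))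
  to-vertex-dart (into i AX) = x-orbit i zero
  to-vertex-dart (into i CX) = refl ◅ x-orbit (next i) zero
  to-vertex-dart (into i AY) = y-orbit i zero
  to-vertex-dart (into i CY) = refl ◅ y-orbit i zero
  to-vertex-dart (into i AB) = orbit-iter 0 _
  to-vertex-dart (into i CB) = orbit-iter 1 _
  to-vertex-dart (into i AD) = orbit-iter 0 _
  to-vertex-dart (into i CD) = orbit-iter 1 _
  to-vertex-dart (out  i AX) = orbit-iter 0 _
  to-vertex-dart (out  i AB) = orbit-iter 1 _
  to-vertex-dart (out  i AD) = orbit-iter 2 _
  to-vertex-dart (out  i AY) = orbit-iter 3 _
  to-vertex-dart (out  i CX) = orbit-iter 0 _
  to-vertex-dart (out  i CY) = orbit-iter 1 _
  to-vertex-dart (out  i CD) = orbit-iter 2 _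
  to-vertex-dart (out  i CB) = orbit-iter 3 _

  face-step : ∀ d → face (φ d) ≡ face d
  face-step (out  i AY) = cong (_, XY) (next-prev i)
  face-step (out  i AX) = refl
  face-step (out  i AB) = refl
  face-step (out  i AD) = refl
  face-step (out  i CX) = refl
  face-step (out  i CY) = refl
  face-step (out  i CB) = refl
  face-step (out  i CD) = refl
  face-step (into i AX) = refl
  face-step (into i AY) = refl
  face-step (into i AB) = refl
  face-step (into i AD) = refl
  face-step (into i CX) = refl
  face-step (into i CY) = refl
  face-step (into i CB) = refl
  face-step (into i CD) = refl

  quadrilateral : ∀ d → Quadrilateral tail φ d
  quadrilateral (into i AX) = cong (λ j → into j AX) (next-prev i) , (λ ()) , (λ ()) , (λ ()) , (λ ()) , (λ ()) , (λ ())
  quadrilateral (out  i AY) = cong (λ j → out j AY) (next-prev i) , (λ ()) , (λ ()) , (λ ()) , (λ ()) , (λ ()) , (λ ())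
  quadrilateral (into i CY) = cong (λ j → into j CY) (prev-next i) , (λ ()) , (λ ()) , (λ ()) , (λ ()) , (λ ()) , (λ ())
  quadrilateral (out  i CX) = cong (λ j → out j CX) (prev-next i) , (λ ()) , (λ ()) , (λ ()) , (λ ()) , (λ ()) , (λ ())
  quadrilateral (into i CX) = refl , (λ ()) , (λ ()) , (λ ()) , (λ ()) , (λ ()) , (λ ())
  quadrilateral (out  i CB) = refl , (λ ()) , (λ ()) , (λ ()) , (λ ()) , (λ ()) , (λ ())
  quadrilateral (into i AB) = refl , (λ ()) , (λ ()) , (λ ()) , (λ ()) , (λ ()) , (λ ())
  quadrilateral (out  i AX) = refl , (λ ()) , (λ ()) , (λ ()) , (λ ()) , (λ ()) , (λ ())
  quadrilateral (into i AY) = refl , (λ ()) , (λ ()) , (λ ()) , (λ ()) , (λ ()) , (λ ())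
  quadrilateral (out  i AD) = refl , (λ ()) , (λ ()) , (λ ()) , (λ ()) , (λ ()) , (λ ())
  quadrilateral (into i CD) = refl , (λ ()) , (λ ()) , (λ ()) , (λ ()) , (λ ()) , (λ ())
  quadrilateral (out  i CY) = refl , (λ ()) , (λ ()) , (λ ()) , (λ ()) , (λ ()) , (λ ())
  quadrilateral (out  i AB) = refl , (λ ()) , (λ ()) , (λ ()) , (λ ()) , (λ ()) , (λ ())
  quadrilateral (into i CB) = refl , (λ ()) , (λ ()) , (λ ()) , (λ ()) , (λ ()) , (λ ())
  quadrilateral (out  i CD) = refl , (λ ()) , (λ ()) , (λ ()) , (λ ()) , (λ ()) , (λ ())
  quadrilateral (into i AD) = refl , (λ ()) , (λ ()) , (λ ()) , (λ ()) , (λ ()) , (λ ())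

  corner : Face → Edge × Bool
  corner (i , XY) = out i AY
  corner (i , XB) = out i AX
  corner (i , YD) = out i AD
  corner (i , BD) = out i AB

  face-corner : ∀ F → face (corner F) ≡ F
  face-corner (i , XY) = refl
  face-corner (i , XB) = refl
  face-corner (i , YD) = refl
  face-corner (i , BD) = refl

  tail-corner : ∀ F → tail (corner F) ≡ A (proj₁ F)
  tail-corner (i , XY) = refl
  tail-corner (i , XB) = refl
  tail-corner (i , YD) = refl
  tail-corner (i , BD) = refl

  to-corner : ∀ d → Orbit φ d (corner (face d))
  to-corner (into i AX) = orbit-iter 1 _
  to-corner (out  i AY) = orbit-iter 0 _
  to-corner (into i CY) = orbit-iter 3 _
  to-corner (out  i CX) = orbit-iter 2 _
  to-corner (into i CX) = orbit-iter 3 _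
  to-corner (out  i CB) = orbit-iter 2 _
  to-corner (into i AB) = orbit-iter 1 _
  to-corner (out  i AX) = orbit-iter 0 _
  to-corner (into i AY) = orbit-iter 1 _
  to-corner (out  i AD) = orbit-iter 0 _
  to-corner (into i CD) = orbit-iter 3 _
  to-corner (out  i CY) = orbit-iter 2 _
  to-corner (out  i AB) = orbit-iter 0 _
  to-corner (into i CB) = orbit-iter 3 _
  to-corner (out  i CD) = orbit-iter 2 _
  to-corner (into i AD) = orbit-iter 1 _

  isHub : Vertex → Bool
  isHub (A _) = true
  isHub (C _) = true
  isHub _     = false

  isHub-out : ∀ a → isHub (tail (a , false)) ≡ true
  isHub-out (i , AX) = refl
  isHub-out (i , AY) = refl
  isHub-out (i , AB) = refl
  isHub-out (i , AD) = refl
  isHub-out (i , CX) = refl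
  isHub-out (i , CY) = refl
  isHub-out (i , CB) = refl
  isHub-out (i , CD) = refl

  isHub-into : ∀ a → isHub (tail (a , true)) ≡ false
  isHub-into (i , AX) = refl
  isHub-into (i , AY) = refl
  isHub-into (i , AB) = refl
  isHub-into (i , AD) = refl
  isHub-into (i , CX) = refl
  isHub-into (i , CY) = refl
  isHub-into (i , CB) = refl
  isHub-into (i , CD) = refl

  out≢into : ∀ a a′ → tail (a , false) ≢ tail (a′ , true)
  out≢into a a′ eq with trans (sym (isHub-out a)) (trans (cong isHub eq) (isHub-into a′))
  ... | ()

  edge-between : Vertex → Vertex → Edge
  edge-between (A i) X     = (i , AX)
  edge-between (A i) Y     = (i , AY)
  edge-between (A i) (B _) = (i , AB)
  edge-between (A i) (D _) = (i , AD)
  edge-between (C i) X     = (i , CX)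
  edge-between (C i) Y     = (i , CY)
  edge-between (C i) (B _) = (i , CB)
  edge-between (C i) (D _) = (i , CD)
  edge-between _     _     = (zero , AX)

  edge-between-ends : ∀ a → edge-between (tail (a , false)) (tail (a , true)) ≡ a
  edge-between-ends (i , AX) = refl
  edge-between-ends (i , AY) = refl
  edge-between-ends (i , AB) = refl
  edge-between-ends (i , AD) = refl
  edge-between-ends (i , CX) = refl
  edge-between-ends (i , CY) = refl
  edge-between-ends (i , CB) = refl
  edge-between-ends (i , CD) = refl

  to-X : ∀ v → Star (Adjacent tail) v X
  to-X (A i) = adjacent (out i AX) ◅ ε
  to-X (B i) = adjacent (into i AB) ◅ adjacent (out i AX) ◅ ε
  to-X (C i) = adjacent (out i CX) ◅ ε
  to-X (D i) = adjacent (into i AD) ◅ adjacent (out i AX) ◅ ε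
  to-X X     = ε
  to-X Y     = adjacent (into zero AY) ◅ adjacent (out zero AX) ◅ ε

  map : PlaneMap Vertex Edge Face
  map = record
    { tail       = tail
    ; σ          = σ
    ; σ⁻¹        = σ⁻¹
    ; σ-inv₁     = σ-inv₁
    ; σ-inv₂     = σ-inv₂
    ; σ-tail     = σ-tail
    ; σ-cyclic   = orbit-via-representative tail vertex-dart σ-returns to-vertex-dart
    ; noLoop     = λ a → out≢into a a
    ; noMulti    = λ a a′ p q → trans (sym (edge-between-ends a))
                                      (trans (cong₂ edge-between p q) (edge-between-ends a′))
    ; noMulti'   = λ a a′ p _ → ⊥-elim (out≢into a a′ p)
    ; face       = face
    ; face-surj  = λ F → corner F , face-corner F
    ; face-step  = face-step
    ; face-orbit = orbit-via-representative face corner (periodic⇒returns 3 (proj₁ ∘ quadrilateral)) to-corner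
    ; connected  = λ u v → to-X u ◅◅ reverse Adjacent-sym (to-X v)
    }

  open PlaneMap map using (GuardedBy)

  corner-guardedBy-AB : ∀ F → GuardedBy F (proj₁ F , AB)
  corner-guardedBy-AB F = false , corner F , face-corner F , tail-corner F

  InBlock : Fin m → Vertex → Set
  InBlock i v = ∃[ κ ] v ≡ inj₁ (κ , i)

  BD-in-block : ∀ {i} d → face d ≡ (i , BD) → InBlock i (tail d)
  BD-in-block (out  i AB) refl = _ , refl
  BD-in-block (into i CB) refl = _ , refl
  BD-in-block (out  i CD) refl = _ , refl
  BD-in-block (into i AD) refl = _ , refl
  BD-in-block (out  i AX) ()
  BD-in-block (out  i AY) ()
  BD-in-block (out  i AD) ()
  BD-in-block (out  i CX) ()
  BD-in-block (out  i CY) ()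
  BD-in-block (out  i CB) ()
  BD-in-block (into i AX) ()
  BD-in-block (into i AY) ()
  BD-in-block (into i AB) ()
  BD-in-block (into i CX) ()
  BD-in-block (into i CY) ()
  BD-in-block (into i CD) ()

  end-in-block : ∀ {i} a b → InBlock i (tail (a , b)) → proj₁ a ≡ i
  end-in-block (j , AX) false (_ , refl) = refl
  end-in-block (j , AY) false (_ , refl) = refl
  end-in-block (j , AB) false (_ , refl) = refl
  end-in-block (j , AD) false (_ , refl) = refl
  end-in-block (j , CX) false (_ , refl) = refl
  end-in-block (j , CY) false (_ , refl) = refl
  end-in-block (j , CB) false (_ , refl) = refl
  end-in-block (j , CD) false (_ , refl) = refl
  end-in-block (j , AB) true  (_ , refl) = refl
  end-in-block (j , AD) true  (_ , refl) = refl
  end-in-block (j , CB) true  (_ , refl) = refl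
  end-in-block (j , CD) true  (_ , refl) = refl
  end-in-block (j , AX) true  (_ , ())
  end-in-block (j , AY) true  (_ , ())
  end-in-block (j , CX) true  (_ , ())
  end-in-block (j , CY) true  (_ , ())

  BD-guard-in-block : ∀ {i} a → GuardedBy (i , BD) a → proj₁ a ≡ i
  BD-guard-in-block {i} a (b , d , face-d , tail-d) =
    end-in-block a b (subst (InBlock i) tail-d (BD-in-block d face-d))

  vertices : Vertex ↔ Fin (4 * m + 2)
  vertices = ↔-sym (↔-trans +↔⊎ (*↔× ⊎-↔ ↔-refl))

  edges : Edge ↔ Fin (m * 8)
  edges = ↔-sym *↔×

  faces : Face ↔ Fin (m * 4)
  faces = ↔-sym *↔×

  open Transport map vertices edges faces (euler-count m) public
  open PlaneGraph G using (IsEdgeGuardSet) renaming (GuardedBy to GuardedByᴳ)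

  Γ₀ : Subset (m * 8)
  Γ₀ = concat (replicate m ⁅ AB ⁆)

  ∣Γ₀∣ : ∣ Γ₀ ∣ ≡ m
  ∣Γ₀∣ = trans (∣concat-replicate∣ m {8} ⁅ AB ⁆) (trans (cong (m *_) (∣⁅x⁆∣≡1 {n = 8} AB)) (*-identityʳ m))

  Γ₀-guards : IsEdgeGuardSet Γ₀
  Γ₀-guards F = combine i AB , AB-block∈Γ₀ ,
    subst (λ F → GuardedByᴳ F (combine i AB)) (Inverse.strictlyInverseˡ faces F)
          (guardedBy⁺ (corner-guardedBy-AB F′))
    where
      F′ = Inverse.from faces F
      i  = proj₁ F′
      AB-block∈Γ₀ : combine i AB ∈ Γ₀
      AB-block∈Γ₀ = combine∈concat⁺ (replicate m ⁅ AB ⁆) i AB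
                      (subst (AB ∈_) (sym (lookup-replicate i ⁅ AB ⁆)) (x∈⁅x⁆ AB))

  guard-lower-bound : ∀ Γ → IsEdgeGuardSet Γ → m ≤ ∣ Γ ∣
  guard-lower-bound Γ guards = meetsAllBlocks⇒m≤∣p∣ m Γ meets
    where
      meets : ∀ i → ∃[ j ] combine i j ∈ Γ
      meets i = proj₂ a , subst (λ j → combine j (proj₂ a) ∈ Γ) block-a a∈Γ
        where
          BDᵢ = Inverse.to faces (i , BD)
          g   = proj₁ (guards BDᵢ)
          a   = Inverse.from edges g

          a∈Γ : Inverse.to edges a ∈ Γ
          a∈Γ = subst (_∈ Γ) (sym (Inverse.strictlyInverseˡ edges g)) (proj₁ (proj₂ (guards BDᵢ)))

          block-a : proj₁ a ≡ i
          block-a = BD-guard-in-block a (subst (λ F → GuardedBy F a) (Inverse.strictlyInverseʳ faces (i , BD))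
                                                (guardedBy⁻ {F = BDᵢ} {i = g} (proj₂ (proj₂ (guards BDᵢ)))))

theorem1 : ∀ (k : ℕ) → ∃[ Q ] (IsQuadrangulation {4 * suc k + 2} Q × PlaneGraph.MinEdgeGuard≡ Q (suc k))
theorem1 k = G , quadrangulation quadrilateral , (Γ₀ , Γ₀-guards , ∣Γ₀∣) , guard-lower-bound
  where open Construction k
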